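{- For every p-string $T$, the parameterized suffix automaton $\mathsf{PSAuto}(T)$ has $O(|T|^2)$ nodes and edges, and this is attained in the worst case: for $k\ge1$, let $\Sigma_k=\{\mathtt{a}_1,\dots,\mathtt{a}_k\}$, $\Pi_k=\{\mathtt{x}_1,\dots,\mathtt{x}_k\}$ and $T_k=\mathtt{x}_1\mathtt{a}_1\cdots\mathtt{x}_k\mathtt{a}_k\mathtt{x}_1\mathtt{a}_1\cdots\mathtt{x}_k\mathtt{a}_k$ (so $|T_k|=4k$); then $\mathsf{PSAuto}(T_k)$ has $\Omega(k^2)=\Omega(|T_k|^2)$ nodes.
   Context: $\Sigma$ (static) and $\Pi$ (parameter) are disjoint alphabets; p-strings are strings over $\Sigma\cup\Pi$; $\mathcal{N}$ is the non-negative integers. The prev-encoding $\mathsf{prev}(S)$ of a p-string $S$ is the string over $\Sigma\cup\mathcal{N}$ with $\mathsf{prev}(S)[i]=S[i]$ if $S[i]\in\Sigma$; $=0$ if $S[i]\in\Pi$ does not occur in $S[1:i-1]$; $=i-j$ if $j<i$ is the last earlier position with $S[j]=S[i]\in\Pi$. $\mathsf{PSuffix}(T)=\{\mathsf{prev}(S): S$ a suffix of $T\}$. The parameterized suffix automaton $\mathsf{PSAuto}(T)$ is the minimal deterministic finite automaton over the alphabet $\Sigma\cup\mathcal{N}$ accepting exactly the set $\mathsf{PSuffix}(T)$ (equivalently, obtained by merging isomorphic subtrees of the trie of $\mathsf{PSuffix}(T)$). -}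

module Defs where

open import Data.Nat using (ℕ; zero; suc)
open import Data.Fin using (Fin)
open import Data.Maybe using (Maybe; just; nothing)
open import Data.Sum using (_⊎_; inj₁; inj₂)
open import Data.Sum.Properties using (≡-dec)
open import Data.Product using (_×_; _,_)
open import Data.List using (List; []; _∷_; _++_; map; tails; inits; concatMap;
  mapMaybe; deduplicate; length; head; allFin)
open import Data.Nat.ListAction using (sum)
import Data.List.Properties as LP
open import Data.List.Relation.Unary.All using (All; all?)
open import Data.Nat.Properties using () renaming (_≟_ to _≟ℕ_)
open import Relation.Binary.Definitions using (DecidableEquality)
open import Relation.Binary.PropositionalEquality using (_≡_)
open import Relation.Nullary using (Dec; yes; no; _×-dec_)
import Data.List.Membership.DecPropositional as DecMem

PString : Set → Set → Set
PString Σ Π = List (Σ ⊎ Π)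

PSym : Set → Set
PSym Σ = Σ ⊎ ℕ

module PrevEnc {Σ Π : Set} (_≟Π_ : DecidableEquality Π) where

  -- distance from the current position back to the last occurrence of
  -- parameter x, given the preceding symbols in REVERSED order
  -- (nearest first); nothing if x does not occur.
  lastDist : Π → List (Σ ⊎ Π) → Maybe ℕ
  lastDist x [] = nothing
  lastDist x (inj₁ _ ∷ ys) with lastDist x ys
  ... | just d  = just (suc d)
  ... | nothing = nothing
  lastDist x (inj₂ y ∷ ys) with x ≟Π y
  ... | yes _ = just 1
  ... | no _ with lastDist x ys
  ...   | just d  = just (suc d)
  ...   | nothing = nothing

  encode : List (Σ ⊎ Π) → Σ ⊎ Π → PSym Σ
  encode acc (inj₁ a) = inj₁ a
  encode acc (inj₂ x) with lastDist x acc
  ... | just d  = inj₂ d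
  ... | nothing = inj₂ 0

  prevFrom : List (Σ ⊎ Π) → PString Σ Π → List (PSym Σ)
  prevFrom acc [] = []
  prevFrom acc (c ∷ cs) = encode acc c ∷ prevFrom (c ∷ acc) cs

  prev : PString Σ Π → List (PSym Σ)
  prev S = prevFrom [] S

  PSuffix : PString Σ Π → List (List (PSym Σ))
  PSuffix T = map prev (tails T)

-- Minimal DFA of a finite language L over an alphabet A with decidable
-- equality, obtained by merging isomorphic subtrees of the trie of L:
-- its nodes are the distinct (as sets) left quotients w⁻¹L for w a prefix
-- of a word of L; a node q has an outgoing edge labelled c iff some word
-- of q starts with c.

module MinDFA {A : Set} (_≟A_ : DecidableEquality A) where

  _≟W_ : DecidableEquality (List A)
  _≟W_ = LP.≡-dec _≟A_

  open DecMem _≟W_ using (_∈_; _∈?_)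

  stripPrefix : List A → List A → Maybe (List A)
  stripPrefix [] v = just v
  stripPrefix (a ∷ w) [] = nothing
  stripPrefix (a ∷ w) (b ∷ v) with a ≟A b
  ... | yes _ = stripPrefix w v
  ... | no _  = nothing

  quotient : List A → List (List A) → List (List A)
  quotient w L = mapMaybe (stripPrefix w) L

  SameLang : List (List A) → List (List A) → Set
  SameLang L M = All (_∈ M) L × All (_∈ L) M

  sameLang? : (L M : List (List A)) → Dec (SameLang L M)
  sameLang? L M = all? (_∈? M) L ×-dec all? (_∈? L) M

  states : List (List A) → List (List (List A))
  states L = deduplicate sameLang? (map (λ w → quotient w L) (concatMap inits L))

  numNodes : List (List A) → ℕ
  numNodes L = length (states L)

  outDegree : List (List A) → ℕ
  outDegree q = length (deduplicate _≟A_ (mapMaybe head q))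

  numEdges : List (List A) → ℕ
  numEdges L = sum (map outDegree (states L))

module _ {Σ Π : Set} (_≟Σ_ : DecidableEquality Σ) (_≟Π_ : DecidableEquality Π) where

  private
    _≟S_ : DecidableEquality (PSym Σ)
    _≟S_ = ≡-dec _≟Σ_ _≟ℕ_

  PSAutoNodes : PString Σ Π → ℕ
  PSAutoNodes T = MinDFA.numNodes _≟S_ (PrevEnc.PSuffix _≟Π_ T)

  PSAutoEdges : PString Σ Π → ℕ
  PSAutoEdges T = MinDFA.numEdges _≟S_ (PrevEnc.PSuffix _≟Π_ T)

blockT : (k : ℕ) → PString (Fin k) (Fin k)
blockT k = concatMap (λ i → inj₂ i ∷ inj₁ i ∷ []) (allFin k)

Tk : (k : ℕ) → PString (Fin k) (Fin k)
Tk k = blockT k ++ blockT k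

module Submission where

open import Defs
open import Data.Bool using (true; false)
open import Data.Empty using (⊥-elim)
open import Data.Fin using (Fin; toℕ; fromℕ<; remQuot; combine) renaming (zero to fzero; suc to fsuc)
import Data.Fin.Properties as Fin
open import Data.Fin.Properties using () renaming (_≟_ to _≟Fin_)
open import Data.List using (List; []; _∷_; _++_; map; take; drop; inits; tails; concatMap; mapMaybe; filter;
  deduplicate; head; lookup; reverse; reverseAcc; tabulate; allFin; length)
import Data.List.Properties as List
open import Data.List.Membership.Propositional using (_∈_; _∉_)
open import Data.List.Membership.Propositional.Properties using (∈-lookup; ∈-map⁺; ∈-map⁻; ∈-concat⁺′)
open import Data.List.Relation.Binary.Subset.Propositional using (_⊆_)
open import Data.List.Relation.Unary.All as All using (All; []; _∷_)
import Data.List.Relation.Unary.All.Properties as All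
open import Data.List.Relation.Unary.AllPairs as AllPairs using (AllPairs; []; _∷_)
import Data.List.Relation.Unary.AllPairs.Properties as AllPairsₚ
open import Data.List.Relation.Unary.Any as Any using (Any; here; there)
import Data.List.Relation.Unary.Any.Properties as Any
open import Data.List.Relation.Unary.Unique.Propositional using (Unique)
open import Data.Maybe using (Maybe; just; nothing)
open import Data.Nat using (ℕ; zero; suc; _+_; _*_; _∸_; _≤_; _<_; z≤n; s≤s; ⌊_/2⌋)
open import Data.Nat.ListAction using (sum)
open import Data.Nat.Properties renaming (_≟_ to _≟ℕ_)
open import Algebra.Properties.CommutativeSemigroup +-commutativeSemigroup using (x∙yz≈y∙xz)
open import Data.Nat.Solver using (module +-*-Solver)
open import Data.Product using (Σ-syntax; ∃; _×_; _,_; proj₁; proj₂; uncurry)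
open import Data.Product.Properties using (×-≡,≡→≡)
open import Data.Sum using (_⊎_; inj₁; inj₂)
import Data.Sum.Properties as Sum
open import Data.Sum.Properties using (≡-dec)
open import Function using (_∘_; id)
open import Level using (0ℓ)
open import Relation.Binary.Core using (Rel)
open import Relation.Binary.Definitions using (DecidableEquality; Decidable; tri<; tri≈; tri>)
open import Relation.Binary.PropositionalEquality
open import Relation.Nullary using (Dec; ¬_; ¬?; does; yes; no)

-- Upper bound.  Every state of the minimal automaton of a finite language L is a left
-- quotient w⁻¹L with w a prefix of a word of L, so there are at most Σ_{x ∈ L} (|x| + 1)
-- states.  The out-degree of w⁻¹L is at most |w⁻¹L|; summed over pairwise distinct
-- representatives w this counts pairs (w, x) with x ∈ L and w a prefix of x, again at most
-- Σ_{x ∈ L} (|x| + 1).  For L = PSuffix(T) the sum is at most (|T| + 1)².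
--
-- Lower bound.  Index T_k from 0, so that x_i occurs at positions 2i and 2k + 2i.  For
-- d ≥ 1 and i + d ≤ k let w(i, d) be the prefix of length 2d of prev(T_k[2i..]).  Every
-- encoded suffix having w(i, d) as a prefix starts at 2i or later, since the second symbol
-- of w(i, d) is a_i; hence the quotient of w(i, d) determines the end 2i + 2d of the
-- occurrence and the remainder of prev(T_k[2i..]).  For equal ends and i < j the remainders
-- differ at position 2k + 2i of T_k: seen from 2i it is the second occurrence of x_i (a
-- positive distance), seen from 2j > 2i its first one (0).  So the ⌊k/2⌋² pairs with
-- i, d - 1 < ⌊k/2⌋ give distinct states.

lookup-injective : ∀ {A : Set} {xs : List A} → Unique xs →
                   ∀ i j → lookup xs i ≡ lookup xs j → i ≡ j
lookup-injective {xs = _ ∷ _}  (_ ∷ _)  fzero    fzero    _ = refl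
lookup-injective {xs = _ ∷ xs} (x∉ ∷ _) fzero    (fsuc j) e = ⊥-elim (All.lookup x∉ (∈-lookup {xs = xs} j) e)
lookup-injective {xs = _ ∷ xs} (x∉ ∷ _) (fsuc i) fzero    e = ⊥-elim (All.lookup x∉ (∈-lookup {xs = xs} i) (sym e))
lookup-injective {xs = _ ∷ _}  (_ ∷ u)  (fsuc i) (fsuc j) e = cong fsuc (lookup-injective u i j e)

Unique-⊆⇒length≤ : ∀ {A : Set} {xs ys : List A} → Unique xs → xs ⊆ ys → length xs ≤ length ys
Unique-⊆⇒length≤ {xs = xs} {ys} u xs⊆ys = Fin.injective⇒≤ {f = position} position-injective
  where
  position : Fin (length xs) → Fin (length ys)
  position i = Any.index (xs⊆ys (∈-lookup i))

  position-injective : ∀ {i j} → position i ≡ position j → i ≡ j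
  position-injective {i} {j} e = lookup-injective u i j (begin
    lookup xs i             ≡⟨ Any.lookup-index (xs⊆ys (∈-lookup i)) ⟩
    lookup ys (position i)  ≡⟨ cong (lookup ys) e ⟩
    lookup ys (position j)  ≡⟨ Any.lookup-index (xs⊆ys (∈-lookup j)) ⟨
    lookup xs j             ∎)
    where open ≡-Reasoning

module _ {A B : Set} (f : A → Maybe B) where

  ∈-mapMaybe⁻ : ∀ xs {y} → y ∈ mapMaybe f xs → ∃ λ x → x ∈ xs × f x ≡ just y
  ∈-mapMaybe⁻ (x ∷ xs) y∈ with f x in fx
  ∈-mapMaybe⁻ (x ∷ xs) (here refl) | just _ = x , here refl , fx
  ∈-mapMaybe⁻ (x ∷ xs) (there y∈)  | just _ with ∈-mapMaybe⁻ xs y∈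
  ... | z , z∈ , fz = z , there z∈ , fz
  ∈-mapMaybe⁻ (x ∷ xs) y∈          | nothing with ∈-mapMaybe⁻ xs y∈
  ... | z , z∈ , fz = z , there z∈ , fz

  ∈-mapMaybe⁺ : ∀ xs {x y} → x ∈ xs → f x ≡ just y → y ∈ mapMaybe f xs
  ∈-mapMaybe⁺ (x ∷ xs) (here refl) fx rewrite fx = here refl
  ∈-mapMaybe⁺ (x ∷ xs) (there x∈)  fx with f x
  ... | just _  = there (∈-mapMaybe⁺ xs x∈ fx)
  ... | nothing = ∈-mapMaybe⁺ xs x∈ fx

  Unique-mapMaybe⁺ : (∀ {x x′ y} → f x ≡ just y → f x′ ≡ just y → x ≡ x′) →
                     ∀ {xs} → Unique xs → Unique (mapMaybe f xs)
  Unique-mapMaybe⁺ inj {[]}     []       = []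
  Unique-mapMaybe⁺ inj {x ∷ xs} (x∉ ∷ u) with f x in fx
  ... | nothing = Unique-mapMaybe⁺ inj u
  ... | just y  = All.tabulate y∉ ∷ Unique-mapMaybe⁺ inj u
    where
    y∉ : ∀ {y′} → y′ ∈ mapMaybe f xs → y ≢ y′
    y∉ y′∈ refl with ∈-mapMaybe⁻ xs y′∈
    ... | z , z∈ , fz = All.lookup x∉ z∈ (inj fx fz)

length-concatMap : ∀ {A B : Set} (f : A → List B) xs → length (concatMap f xs) ≡ sum (map (length ∘ f) xs)
length-concatMap f []       = refl
length-concatMap f (x ∷ xs) = trans (List.length-++ (f x)) (cong (length (f x) +_) (length-concatMap f xs))

length-inits : ∀ {A : Set} (xs : List A) → length (inits xs) ≡ suc (length xs)
length-inits []       = refl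
length-inits (x ∷ xs) = cong suc (trans (List.length-map (x ∷_) (inits xs)) (length-inits xs))

length-tails : ∀ {A : Set} (xs : List A) → length (tails xs) ≡ suc (length xs)
length-tails []       = refl
length-tails (x ∷ xs) = cong suc (length-tails xs)

take-∈-inits : ∀ {A : Set} n (xs : List A) → take n xs ∈ inits xs
take-∈-inits zero    []       = here refl
take-∈-inits zero    (x ∷ xs) = here refl
take-∈-inits (suc n) []       = here refl
take-∈-inits (suc n) (x ∷ xs) = there (∈-map⁺ (x ∷_) (take-∈-inits n xs))

drop-∈-tails : ∀ {A : Set} t (xs : List A) → drop t xs ∈ tails xs
drop-∈-tails zero    []       = here refl
drop-∈-tails zero    (x ∷ xs) = here refl
drop-∈-tails (suc t) []       = here refl
drop-∈-tails (suc t) (x ∷ xs) = there (drop-∈-tails t xs)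

++-∈-tails : ∀ {A : Set} (xs ys : List A) → ys ∈ tails (xs ++ ys)
++-∈-tails []       []       = here refl
++-∈-tails []       (y ∷ ys) = here refl
++-∈-tails (x ∷ xs) ys       = there (++-∈-tails xs ys)

∈-tails⁻ : ∀ {A : Set} (xs : List A) {ys} → ys ∈ tails xs → ∃ λ t → t ≤ length xs × ys ≡ drop t xs
∈-tails⁻ []       (here refl)  = 0 , z≤n , refl
∈-tails⁻ (x ∷ xs) (here refl)  = 0 , z≤n , refl
∈-tails⁻ (x ∷ xs) (there ys∈) with ∈-tails⁻ xs ys∈
... | t , t≤ , refl = suc t , s≤s t≤ , refl

tails-shorter : ∀ {A : Set} (xs : List A) → All (λ ys → length ys ≤ length xs) (tails xs)
tails-shorter []       = z≤n ∷ []
tails-shorter (x ∷ xs) = ≤-refl ∷ All.map m≤n⇒m≤1+n (tails-shorter xs)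

module _ {A B : Set} (g : A → B) where

  filter-map : ∀ {P : B → Set} (P? : ∀ b → Dec (P b)) xs →
               filter P? (map g xs) ≡ map g (filter (P? ∘ g) xs)
  filter-map P? []       = refl
  filter-map P? (x ∷ xs) with does (P? (g x))
  ... | true  = cong (g x ∷_) (filter-map P? xs)
  ... | false = filter-map P? xs

  deduplicate-map : ∀ {R : Rel B 0ℓ} (R? : Decidable R) xs →
                    deduplicate R? (map g xs) ≡ map g (deduplicate (λ a a′ → R? (g a) (g a′)) xs)
  deduplicate-map R? []       = refl
  deduplicate-map R? (x ∷ xs) = cong (g x ∷_) (trans
    (cong (filter (¬? ∘ R? (g x))) (deduplicate-map R? xs))
    (filter-map (¬? ∘ R? (g x)) (deduplicate _ xs)))

deduplicate-AllPairs : ∀ {A : Set} {R : Rel A 0ℓ} (R? : Decidable R) xs →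
                       AllPairs (λ a b → ¬ R a b) (deduplicate R? xs)
deduplicate-AllPairs R? []       = []
deduplicate-AllPairs R? (x ∷ xs) =
  All.all-filter (¬? ∘ R? x) (deduplicate R? xs) ∷ AllPairsₚ.filter⁺ (¬? ∘ R? x) (deduplicate-AllPairs R? xs)

sum-mono-≤ : ∀ {A : Set} {f g : A → ℕ} xs → (∀ x → f x ≤ g x) → sum (map f xs) ≤ sum (map g xs)
sum-mono-≤ []       f≤g = z≤n
sum-mono-≤ (x ∷ xs) f≤g = +-mono-≤ (f≤g x) (sum-mono-≤ xs f≤g)

sum-≤-length* : ∀ {A : Set} (f : A → ℕ) {b} xs → All (λ x → f x ≤ b) xs → sum (map f xs) ≤ length xs * b
sum-≤-length* f []       []           = z≤n
sum-≤-length* f (x ∷ xs) (fx≤b ∷ f≤b) = +-mono-≤ fx≤b (sum-≤-length* f xs f≤b)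

module _ {A B C : Set} (f : A → B → Maybe C) where

  private
    column : List A → B → ℕ
    column as b = length (mapMaybe (λ a → f a b) as)

    add-row : ∀ a as bs → length (mapMaybe (f a) bs) + sum (map (column as) bs) ≡ sum (map (column (a ∷ as)) bs)
    add-row a as []       = refl
    add-row a as (b ∷ bs) with f a b | x∙yz≈y∙xz (length (mapMaybe (f a) bs)) (column as b) (sum (map (column as) bs))
    ... | just _  | swap = cong suc (trans swap (cong (column as b +_) (add-row a as bs)))
    ... | nothing | swap = trans swap (cong (column as b +_) (add-row a as bs))

  sum-length-mapMaybe-swap : ∀ as bs → sum (map (λ a → length (mapMaybe (f a) bs)) as)
                                     ≡ sum (map (λ b → length (mapMaybe (λ a → f a b) as)) bs)
  sum-length-mapMaybe-swap []       []       = refl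
  sum-length-mapMaybe-swap []       (_ ∷ bs) = sum-length-mapMaybe-swap [] bs
  sum-length-mapMaybe-swap (a ∷ as) bs       =
    trans (cong (length (mapMaybe (f a) bs) +_) (sum-length-mapMaybe-swap as bs)) (add-row a as bs)

infix 4 _[_]=_

data _[_]=_ {A : Set} : List A → ℕ → A → Set where
  here  : ∀ {x xs} → x ∷ xs [ 0 ]= x
  there : ∀ {x y xs i} → xs [ i ]= x → y ∷ xs [ suc i ]= x

module _ {A : Set} where

  []=⇒drop : ∀ {xs : List A} {i x} → xs [ i ]= x → ∃ λ rest → drop i xs ≡ x ∷ rest
  []=⇒drop (here {xs = xs}) = xs , refl
  []=⇒drop (there x∈)       = []=⇒drop x∈

  drop⇒[]= : ∀ (xs : List A) i {x rest} → drop i xs ≡ x ∷ rest → xs [ i ]= x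
  drop⇒[]= (_ ∷ _)  zero    refl = here
  drop⇒[]= (_ ∷ xs) (suc i) e    = there (drop⇒[]= xs i e)

  []=⇒∈ : ∀ {xs : List A} {i x} → xs [ i ]= x → x ∈ xs
  []=⇒∈ here       = here refl
  []=⇒∈ (there x∈) = there ([]=⇒∈ x∈)

  []=-functional : ∀ {xs : List A} {i x y} → xs [ i ]= x → xs [ i ]= y → x ≡ y
  []=-functional here       here       = refl
  []=-functional (there x∈) (there y∈) = []=-functional x∈ y∈

  []=-drop⁻ : ∀ {xs : List A} t {i x} → drop t xs [ i ]= x → xs [ t + i ]= x
  []=-drop⁻ {xs}     zero    x∈ = x∈
  []=-drop⁻ {_ ∷ xs} (suc t) x∈ = there ([]=-drop⁻ t x∈)

  []=-drop⁺ : ∀ {xs : List A} t {i x} → xs [ t + i ]= x → drop t xs [ i ]= x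
  []=-drop⁺ zero    x∈         = x∈
  []=-drop⁺ (suc t) (there x∈) = []=-drop⁺ t x∈

  []=-++ˡ : ∀ {xs : List A} ys {i x} → xs [ i ]= x → xs ++ ys [ i ]= x
  []=-++ˡ ys here       = here
  []=-++ˡ ys (there x∈) = there ([]=-++ˡ ys x∈)

  []=-++ʳ : ∀ (xs : List A) {ys i y} → ys [ i ]= y → xs ++ ys [ length xs + i ]= y
  []=-++ʳ []       y∈ = y∈
  []=-++ʳ (_ ∷ xs) y∈ = there ([]=-++ʳ xs y∈)

  []=-++⁻ : ∀ (xs : List A) {ys i y} → xs ++ ys [ i ]= y →
            xs [ i ]= y ⊎ ∃ λ j → i ≡ length xs + j × ys [ j ]= y
  []=-++⁻ []       {i = i} y∈ = inj₂ (i , refl , y∈)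
  []=-++⁻ (_ ∷ xs) here       = inj₁ here
  []=-++⁻ (_ ∷ xs) (there y∈) with []=-++⁻ xs y∈
  ... | inj₁ y∈xs           = inj₁ (there y∈xs)
  ... | inj₂ (j , e , y∈ys) = inj₂ (j , cong suc e , y∈ys)

  []=-take⁺ : ∀ {xs : List A} {i x} n → i < n → xs [ i ]= x → take n xs [ i ]= x
  []=-take⁺ (suc n) _         here       = here
  []=-take⁺ (suc n) (s≤s i<n) (there x∈) = there ([]=-take⁺ n i<n x∈)

  ∈-take⁻ : ∀ n (xs : List A) {x} → x ∈ take n xs → ∃ λ i → i < n × xs [ i ]= x
  ∈-take⁻ (suc n) (x ∷ xs) (here refl) = 0 , s≤s z≤n , here
  ∈-take⁻ (suc n) (_ ∷ xs) (there x∈) with ∈-take⁻ n xs x∈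
  ... | i , i<n , x∈xs = suc i , s≤s i<n , there x∈xs

  tabulate-[]=⁺ : ∀ {n} (f : Fin n → A) i → tabulate f [ toℕ i ]= f i
  tabulate-[]=⁺ f fzero    = here
  tabulate-[]=⁺ f (fsuc i) = there (tabulate-[]=⁺ (f ∘ fsuc) i)

  tabulate-[]=⁻ : ∀ {n} (f : Fin n → A) {j y} → tabulate f [ j ]= y → ∃ λ i → toℕ i ≡ j × f i ≡ y
  tabulate-[]=⁻ {suc n} f here       = fzero , refl , refl
  tabulate-[]=⁻ {suc n} f (there y∈) with tabulate-[]=⁻ (f ∘ fsuc) y∈
  ... | i , refl , fi≡y = fsuc i , refl , fi≡y

  interleave : List A → List (A ⊎ A)
  interleave = concatMap (λ a → inj₂ a ∷ inj₁ a ∷ [])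

  length-interleave : ∀ as → length (interleave as) ≡ length as + length as
  length-interleave []       = refl
  length-interleave (a ∷ as) = cong suc (trans (cong suc (length-interleave as)) (sym (+-suc _ _)))

  interleave-[]=⁺ : ∀ {as j a} → as [ j ]= a →
                    interleave as [ j + j ]= inj₂ a × interleave as [ suc (j + j) ]= inj₁ a
  interleave-[]=⁺ here = here , there here
  interleave-[]=⁺ {j = suc j} (there a∈) with interleave-[]=⁺ a∈
  ... | a₂∈ , a₁∈ rewrite +-suc j j = there (there a₂∈) , there (there a₁∈)

  interleave-[]=-inj₂⁻ : ∀ as {p a} → interleave as [ p ]= inj₂ a → ∃ λ j → p ≡ j + j × as [ j ]= a
  interleave-[]=-inj₂⁻ (_ ∷ as) here               = 0 , refl , here
  interleave-[]=-inj₂⁻ (_ ∷ as) (there (there a∈)) with interleave-[]=-inj₂⁻ as a∈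
  ... | j , refl , a∈as = suc j , cong suc (sym (+-suc j j)) , there a∈as

  interleave-[]=-inj₁⁻ : ∀ as {p a} → interleave as [ p ]= inj₁ a → ∃ λ j → p ≡ suc (j + j) × as [ j ]= a
  interleave-[]=-inj₁⁻ (_ ∷ as) (there here)       = 0 , refl , here
  interleave-[]=-inj₁⁻ (_ ∷ as) (there (there a∈)) with interleave-[]=-inj₁⁻ as a∈
  ... | j , refl , a∈as = suc j , cong (suc ∘ suc) (sym (+-suc j j)) , there a∈as

-- Minimal automata of finite languages

module MinDFABounds {A : Set} (_≟A_ : DecidableEquality A) where

  open MinDFA _≟A_

  prefixes : List (List A) → List (List A)
  prefixes L = concatMap inits L

  stripPrefix-++ : ∀ w v → stripPrefix w (w ++ v) ≡ just v
  stripPrefix-++ []      v = refl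
  stripPrefix-++ (a ∷ w) v with a ≟A a
  ... | yes _  = stripPrefix-++ w v
  ... | no a≢a = ⊥-elim (a≢a refl)

  stripPrefix-just⁻ : ∀ w x {v} → stripPrefix w x ≡ just v → x ≡ w ++ v
  stripPrefix-just⁻ []      x       refl = refl
  stripPrefix-just⁻ (a ∷ w) []      ()
  stripPrefix-just⁻ (a ∷ w) (b ∷ x) eq with a ≟A b
  ... | yes refl = cong (a ∷_) (stripPrefix-just⁻ w x eq)
  ... | no _     with () ← eq

  SameLang-refl : ∀ L → SameLang L L
  SameLang-refl L = All.tabulate id , All.tabulate id

  SameLang-sym : ∀ {L M} → SameLang L M → SameLang M L
  SameLang-sym (L⊆M , M⊆L) = M⊆L , L⊆M

  SameLang-trans : ∀ {L M N} → SameLang L M → SameLang M N → SameLang L N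
  SameLang-trans (L⊆M , M⊆L) (M⊆N , N⊆M) = All.map (All.lookup M⊆N) L⊆M , All.map (All.lookup M⊆L) N⊆M

  length-prefixes : ∀ L → length (prefixes L) ≡ sum (map (suc ∘ length) L)
  length-prefixes L = trans (length-concatMap inits L) (cong sum (List.map-cong length-inits L))

  numNodes≤length-prefixes : ∀ L → numNodes L ≤ length (prefixes L)
  numNodes≤length-prefixes L = ≤-trans (List.length-deduplicate sameLang? (map (λ w → quotient w L) (prefixes L)))
                                       (≤-reflexive (List.length-map _ (prefixes L)))

  numNodes-lowerBound : ∀ {m} L (w : Fin m → List A) → (∀ i → w i ∈ prefixes L) →
                        (∀ i j → SameLang (quotient (w i) L) (quotient (w j) L) → i ≡ j) →
                        m ≤ numNodes L
  numNodes-lowerBound L w w∈ separated = Fin.injective⇒≤ {f = state} state-injective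
    where
    Represents : Fin _ → List (List A) → Set
    Represents i q = SameLang q (quotient (w i) L)

    represented : ∀ i → Any (Represents i) (states L)
    represented i = Any.deduplicate⁺ sameLang? SameLang-trans
                      (Any.map⁺ (Any.map (λ { refl → SameLang-refl _ }) (w∈ i)))

    state : Fin _ → Fin (numNodes L)
    state i = Any.index (represented i)

    state-injective : ∀ {i j} → state i ≡ state j → i ≡ j
    state-injective {i} {j} e = separated i j (SameLang-trans (SameLang-sym (Any.lookup-index (represented i)))
      (subst (λ s → Represents j (lookup (states L) s)) (sym e) (Any.lookup-index (represented j))))

  prefixesIn : List (List A) → List A → List (List A)
  prefixesIn W x = mapMaybe (λ w → stripPrefix w x) W

  length-prefixesIn≤ : ∀ {W} → Unique W → ∀ x → length (prefixesIn W x) ≤ suc (length x)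
  length-prefixesIn≤ {W} u x = begin
    length (prefixesIn W x)  ≤⟨ Unique-⊆⇒length≤ (Unique-mapMaybe⁺ _ same-suffix u) suffix ⟩
    length (tails x)         ≡⟨ length-tails x ⟩
    suc (length x)           ∎
    where
    open ≤-Reasoning
    same-suffix : ∀ {w w′ v} → stripPrefix w x ≡ just v → stripPrefix w′ x ≡ just v → w ≡ w′
    same-suffix {w} {w′} {v} e e′ =
      List.++-cancelʳ v w w′ (trans (sym (stripPrefix-just⁻ w x e)) (stripPrefix-just⁻ w′ x e′))
    suffix : prefixesIn W x ⊆ tails x
    suffix v∈ with ∈-mapMaybe⁻ _ W v∈
    ... | w , _ , e = subst (λ y → _ ∈ tails y) (sym (stripPrefix-just⁻ w x e)) (++-∈-tails w _)

  numEdges≤ : ∀ L → numEdges L ≤ sum (map (suc ∘ length) L)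
  numEdges≤ L = begin
    sum (map outDegree (states L))       ≡⟨ cong (sum ∘ map outDegree) (deduplicate-map q sameLang? (prefixes L)) ⟩
    sum (map outDegree (map q W))        ≡⟨ cong sum (List.map-∘ W) ⟨
    sum (map (outDegree ∘ q) W)          ≤⟨ sum-mono-≤ W (λ w → outDegree≤length (q w)) ⟩
    sum (map (length ∘ q) W)             ≡⟨ sum-length-mapMaybe-swap stripPrefix W L ⟩
    sum (map (length ∘ prefixesIn W) L)  ≤⟨ sum-mono-≤ L (length-prefixesIn≤ W-unique) ⟩
    sum (map (suc ∘ length) L)           ∎
    where
    open ≤-Reasoning
    q : List A → List (List A)
    q w = quotient w L
    W : List (List A)
    W = deduplicate (λ w w′ → sameLang? (q w) (q w′)) (prefixes L)
    W-unique : Unique W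
    W-unique = AllPairs.map (λ {w} ¬same w≡w′ → ¬same (subst (SameLang (q w) ∘ q) w≡w′ (SameLang-refl (q w))))
                 (deduplicate-AllPairs _ (prefixes L))
    outDegree≤length : ∀ q → outDegree q ≤ length q
    outDegree≤length q = ≤-trans (List.length-deduplicate _≟A_ (mapMaybe head q)) (List.length-mapMaybe head q)

-- Prev-encodings

module PrevEncProperties {Σ Π : Set} (_≟Π_ : DecidableEquality Π) where

  open PrevEnc {Σ} {Π} _≟Π_

  length-prevFrom : ∀ acc S → length (prevFrom acc S) ≡ length S
  length-prevFrom acc []      = refl
  length-prevFrom acc (c ∷ S) = cong suc (length-prevFrom (c ∷ acc) S)

  drop-prevFrom : ∀ j acc S → drop j (prevFrom acc S) ≡ prevFrom (reverseAcc acc (take j S)) (drop j S)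
  drop-prevFrom zero    acc S       = refl
  drop-prevFrom (suc j) acc []      = refl
  drop-prevFrom (suc j) acc (c ∷ S) = drop-prevFrom j (c ∷ acc) S

  lastDist-∈ : ∀ x acc → inj₂ x ∈ acc → ∃ λ d → lastDist x acc ≡ just (suc d)
  lastDist-∈ x (inj₁ _ ∷ acc) (there x∈) with lastDist-∈ x acc x∈
  ... | d , e rewrite e = suc d , refl
  lastDist-∈ x (inj₂ y ∷ acc) x∈ with x ≟Π y
  ... | yes _ = 0 , refl
  lastDist-∈ x (inj₂ y ∷ acc) (here refl) | no x≢y = ⊥-elim (x≢y refl)
  lastDist-∈ x (inj₂ y ∷ acc) (there x∈)  | no _ with lastDist-∈ x acc x∈
  ... | d , e rewrite e = suc d , refl

  lastDist-∉ : ∀ x acc → inj₂ x ∉ acc → lastDist x acc ≡ nothing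
  lastDist-∉ x []             _  = refl
  lastDist-∉ x (inj₁ _ ∷ acc) x∉ rewrite lastDist-∉ x acc (x∉ ∘ there) = refl
  lastDist-∉ x (inj₂ y ∷ acc) x∉ with x ≟Π y
  ... | yes refl = ⊥-elim (x∉ (here refl))
  ... | no _ rewrite lastDist-∉ x acc (x∉ ∘ there) = refl

  encode-inj₁⁻ : ∀ acc c {a} → encode acc c ≡ inj₁ a → c ≡ inj₁ a
  encode-inj₁⁻ acc (inj₁ b) refl = refl
  encode-inj₁⁻ acc (inj₂ y) e with lastDist y acc
  encode-inj₁⁻ acc (inj₂ y) () | just _
  encode-inj₁⁻ acc (inj₂ y) () | nothing

  prev-[]= : ∀ S {i c} → S [ i ]= c → prev S [ i ]= encode (reverse (take i S)) c
  prev-[]= S {i} c∈ with []=⇒drop c∈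
  ... | rest , e = drop⇒[]= (prev S) i (trans (drop-prevFrom i [] S) (cong (prevFrom _) e))

  prev-[]=-inj₁⁻ : ∀ S {i a} → prev S [ i ]= inj₁ a → S [ i ]= inj₁ a
  prev-[]=-inj₁⁻ S {i} a∈ = go (drop i S) refl (trans (sym (drop-prevFrom i [] S)) (proj₂ ([]=⇒drop a∈)))
    where
    go : ∀ {a acc r} S′ → drop i S ≡ S′ → prevFrom acc S′ ≡ inj₁ a ∷ r → S [ i ]= inj₁ a
    go (c ∷ rest) eq e = drop⇒[]= S i (trans eq (cong (_∷ rest) (encode-inj₁⁻ _ c (List.∷-injectiveˡ e))))

  prev-[]=-fresh : ∀ S {i x} → S [ i ]= inj₂ x → inj₂ x ∉ take i S → prev S [ i ]= inj₂ 0
  prev-[]=-fresh S {i} {x} x∈ x∉ = subst (prev S [ i ]=_) encode≡0 (prev-[]= S x∈)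
    where
    encode≡0 : encode (reverse (take i S)) (inj₂ x) ≡ inj₂ 0
    encode≡0 rewrite lastDist-∉ x (reverse (take i S)) (x∉ ∘ Any.reverse⁻) = refl

  prev-[]=-repeated : ∀ S {i x} → S [ i ]= inj₂ x → inj₂ x ∈ take i S → ∃ λ d → prev S [ i ]= inj₂ (suc d)
  prev-[]=-repeated S {i} {x} x∈ x∈take with lastDist-∈ x (reverse (take i S)) (Any.reverse⁺ x∈take)
  ... | d , e = d , subst (prev S [ i ]=_) encode≡ (prev-[]= S x∈)
    where
    encode≡ : encode (reverse (take i S)) (inj₂ x) ≡ inj₂ (suc d)
    encode≡ rewrite e = refl

-- The upper bound

module _ {Σ Π : Set} (_≟Σ_ : DecidableEquality Σ) (_≟Π_ : DecidableEquality Π) where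

  open PrevEnc {Σ} {Π} _≟Π_
  open PrevEncProperties {Σ} {Π} _≟Π_
  open MinDFABounds {PSym Σ} (≡-dec _≟Σ_ _≟ℕ_)

  sum-length-PSuffix≤ : ∀ T → sum (map (suc ∘ length) (PSuffix T)) ≤ suc (length T) * suc (length T)
  sum-length-PSuffix≤ T = begin
    sum (map (suc ∘ length) (map prev (tails T)))
      ≡⟨ cong sum (List.map-∘ {g = suc ∘ length} {f = prev} (tails T)) ⟨
    sum (map (suc ∘ length ∘ prev) (tails T))
      ≡⟨ cong sum (List.map-cong (cong suc ∘ length-prevFrom []) (tails T)) ⟩
    sum (map (suc ∘ length) (tails T))
      ≤⟨ sum-≤-length* (suc ∘ length) (tails T) (All.map s≤s (tails-shorter T)) ⟩
    length (tails T) * suc (length T)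
      ≡⟨ cong (_* suc (length T)) (length-tails T) ⟩
    suc (length T) * suc (length T)
      ∎
    where open ≤-Reasoning

  PSAutoNodes≤ : ∀ T → PSAutoNodes _≟Σ_ _≟Π_ T ≤ suc (length T) * suc (length T)
  PSAutoNodes≤ T = ≤-trans (numNodes≤length-prefixes (PSuffix T))
                     (≤-trans (≤-reflexive (length-prefixes (PSuffix T))) (sum-length-PSuffix≤ T))

  PSAutoEdges≤ : ∀ T → PSAutoEdges _≟Σ_ _≟Π_ T ≤ suc (length T) * suc (length T)
  PSAutoEdges≤ T = ≤-trans (numEdges≤ (PSuffix T)) (sum-length-PSuffix≤ T)

suc*suc≤4* : ∀ n → 1 ≤ n → suc n * suc n ≤ 4 * (n * n)
suc*suc≤4* n 1≤n = begin
  suc n * suc n      ≤⟨ *-mono-≤ 1+n≤n+n 1+n≤n+n ⟩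
  (n + n) * (n + n)  ≡⟨ solve 1 (λ n → (n :+ n) :* (n :+ n) := con 4 :* (n :* n)) refl n ⟩
  4 * (n * n)        ∎
  where
  open ≤-Reasoning
  open +-*-Solver
  1+n≤n+n : suc n ≤ n + n
  1+n≤n+n = subst (_≤ n + n) (+-comm n 1) (+-monoʳ-≤ n 1≤n)

-- The strings T_k

offset : ∀ {k} → Fin k → ℕ
offset x = toℕ x + toℕ x

module _ {k : ℕ} where

  allFin-[]=⁻ : ∀ {j x} → allFin k [ j ]= x → toℕ x ≡ j
  allFin-[]=⁻ x∈ with tabulate-[]=⁻ id x∈
  ... | _ , toℕi≡j , refl = toℕi≡j

  length-blockT : length (blockT k) ≡ k + k
  length-blockT = trans (length-interleave (allFin k)) (cong (λ n → n + n) (List.length-tabulate {n = k} id))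

  length-Tk : length (Tk k) ≡ (k + k) + (k + k)
  length-Tk = trans (List.length-++ (blockT k)) (cong₂ _+_ length-blockT length-blockT)

  blockT-[]=-inj₂⁻ : ∀ {p x} → blockT k [ p ]= inj₂ x → p ≡ offset x
  blockT-[]=-inj₂⁻ x∈ with interleave-[]=-inj₂⁻ (allFin k) x∈
  ... | j , refl , x∈allFin rewrite allFin-[]=⁻ x∈allFin = refl

  blockT-[]=-inj₁⁻ : ∀ {p x} → blockT k [ p ]= inj₁ x → p ≡ suc (offset x)
  blockT-[]=-inj₁⁻ x∈ with interleave-[]=-inj₁⁻ (allFin k) x∈
  ... | j , refl , x∈allFin rewrite allFin-[]=⁻ x∈allFin = refl

  Tk-[]=-first : ∀ x → Tk k [ offset x ]= inj₂ x
  Tk-[]=-first x = []=-++ˡ (blockT k) (proj₁ (interleave-[]=⁺ (tabulate-[]=⁺ id x)))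

  Tk-[]=-static : ∀ x → Tk k [ suc (offset x) ]= inj₁ x
  Tk-[]=-static x = []=-++ˡ (blockT k) (proj₂ (interleave-[]=⁺ (tabulate-[]=⁺ id x)))

  Tk-[]=-second : ∀ x → Tk k [ (k + k) + offset x ]= inj₂ x
  Tk-[]=-second x = subst (λ n → Tk k [ n + offset x ]= inj₂ x) length-blockT
                      ([]=-++ʳ (blockT k) (proj₁ (interleave-[]=⁺ (tabulate-[]=⁺ id x))))

  Tk-[]=-inj₂⁻ : ∀ {p x} → Tk k [ p ]= inj₂ x → p ≡ offset x ⊎ p ≡ (k + k) + offset x
  Tk-[]=-inj₂⁻ x∈ with []=-++⁻ (blockT k) x∈
  ... | inj₁ x∈₁              = inj₁ (blockT-[]=-inj₂⁻ x∈₁)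
  ... | inj₂ (j , refl , x∈₂) = inj₂ (cong₂ _+_ length-blockT (blockT-[]=-inj₂⁻ x∈₂))

  Tk-[]=-inj₁⁻ : ∀ {p x} → Tk k [ p ]= inj₁ x → offset x < p
  Tk-[]=-inj₁⁻ {x = x} x∈ with []=-++⁻ (blockT k) x∈
  ... | inj₁ x∈₁              = ≤-reflexive (sym (blockT-[]=-inj₁⁻ x∈₁))
  ... | inj₂ (j , refl , x∈₂) rewrite blockT-[]=-inj₁⁻ x∈₂ = m≤n+m (suc (offset x)) (length (blockT k))

-- The lower bound

module LowerBound (k : ℕ) where

  open PrevEnc {Fin k} {Fin k} _≟Fin_
  open PrevEncProperties {Fin k} {Fin k} _≟Fin_

  -- The same test as the private one inside PSAutoNodes, so that numNodes below is
  -- definitionally PSAutoNodes _≟Fin_ _≟Fin_ (Tk k).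
  _≟S_ : DecidableEquality (PSym (Fin k))
  _≟S_ = ≡-dec _≟Fin_ _≟ℕ_

  open MinDFA _≟S_
  open MinDFABounds _≟S_

  T : PString (Fin k) (Fin k)
  T = Tk k

  N : ℕ
  N = (k + k) + (k + k)

  suffixAt : ℕ → List (PSym (Fin k))
  suffixAt t = prev (drop t T)

  suffixAt-∈ : ∀ t → suffixAt t ∈ PSuffix T
  suffixAt-∈ t = ∈-map⁺ prev (drop-∈-tails t T)

  ∈-PSuffix⁻ : ∀ {z} → z ∈ PSuffix T → ∃ λ t → t ≤ N × z ≡ suffixAt t
  ∈-PSuffix⁻ z∈ with ∈-map⁻ prev z∈
  ... | S , S∈ , refl with ∈-tails⁻ T S∈
  ... | t , t≤ , refl = t , subst (t ≤_) (length-Tk {k}) t≤ , refl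

  length-suffixAt : ∀ {t} → t ≤ N → length (suffixAt t) + t ≡ N
  length-suffixAt {t} t≤N = begin
    length (suffixAt t) + t  ≡⟨ cong (_+ t) (length-prevFrom [] (drop t T)) ⟩
    length (drop t T) + t    ≡⟨ cong (_+ t) (List.length-drop t T) ⟩
    (length T ∸ t) + t       ≡⟨ cong (λ n → (n ∸ t) + t) (length-Tk {k}) ⟩
    (N ∸ t) + t              ≡⟨ m∸n+n≡m t≤N ⟩
    N                        ∎
    where open ≡-Reasoning

  word : Fin k → ℕ → List (PSym (Fin k))
  word x d = take (d + d) (suffixAt (offset x))

  rest : Fin k → ℕ → List (PSym (Fin k))
  rest x d = drop (d + d) (suffixAt (offset x))

  end : Fin k → ℕ → ℕ
  end x d = offset x + (d + d)

  Valid : Fin k → ℕ → Set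
  Valid x d = 0 < d × toℕ x + d ≤ k

  end≤N : ∀ {x d} → Valid x d → end x d ≤ N
  end≤N {x} {d} (_ , x+d≤k) = begin
    offset x + (d + d)         ≡⟨ solve 2 (λ i d → (i :+ i) :+ (d :+ d) := (i :+ d) :+ (i :+ d)) refl (toℕ x) d ⟩
    (toℕ x + d) + (toℕ x + d)  ≤⟨ +-mono-≤ x+d≤k x+d≤k ⟩
    k + k                      ≤⟨ m≤m+n (k + k) (k + k) ⟩
    N                          ∎
    where
    open ≤-Reasoning
    open +-*-Solver

  offset≤N : ∀ {x d} → Valid x d → offset x ≤ N
  offset≤N {x} {d} v = ≤-trans (m≤m+n (offset x) (d + d)) (end≤N v)

  word++rest : ∀ x d → word x d ++ rest x d ≡ suffixAt (offset x)
  word++rest x d = List.take++drop≡id (d + d) (suffixAt (offset x))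

  length-word : ∀ {x d} → Valid x d → length (word x d) ≡ d + d
  length-word {x} {d} v = trans (List.length-take (d + d) (suffixAt (offset x))) (m≤n⇒m⊓n≡m d+d≤)
    where
    d+d≤ : d + d ≤ length (suffixAt (offset x))
    d+d≤ = +-cancelʳ-≤ (offset x) (d + d) _ (begin
      (d + d) + offset x                       ≡⟨ +-comm (d + d) (offset x) ⟩
      end x d                                  ≤⟨ end≤N v ⟩
      N                                        ≡⟨ length-suffixAt (offset≤N v) ⟨
      length (suffixAt (offset x)) + offset x  ∎)
      where open ≤-Reasoning

  length-word++ : ∀ {x d} u → Valid x d → length (word x d ++ u) ≡ (d + d) + length u
  length-word++ {x} {d} u v = trans (List.length-++ (word x d)) (cong (_+ length u) (length-word v))

  length-rest : ∀ {x d} → Valid x d → length (rest x d) + end x d ≡ N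
  length-rest {x} {d} v = begin
    length (rest x d) + (offset x + (d + d))  ≡⟨ solve 3 (λ r o m → r :+ (o :+ m) := (m :+ r) :+ o) refl
                                                   (length (rest x d)) (offset x) (d + d) ⟩
    ((d + d) + length (rest x d)) + offset x  ≡⟨ cong (_+ offset x) (length-word++ (rest x d) v) ⟨
    length (word x d ++ rest x d) + offset x  ≡⟨ cong (λ s → length s + offset x) (word++rest x d) ⟩
    length (suffixAt (offset x)) + offset x   ≡⟨ length-suffixAt (offset≤N v) ⟩
    N                                         ∎
    where
    open ≡-Reasoning
    open +-*-Solver

  word-∈-prefixes : ∀ x d → word x d ∈ prefixes (PSuffix T)
  word-∈-prefixes x d =
    ∈-concat⁺′ (take-∈-inits (d + d) (suffixAt (offset x))) (∈-map⁺ inits (suffixAt-∈ (offset x)))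

  rest-∈-quotient : ∀ x d → rest x d ∈ quotient (word x d) (PSuffix T)
  rest-∈-quotient x d = ∈-mapMaybe⁺ (stripPrefix (word x d)) (PSuffix T) (suffixAt-∈ (offset x))
    (subst (λ s → stripPrefix (word x d) s ≡ just (rest x d)) (word++rest x d) (stripPrefix-++ (word x d) (rest x d)))

  occurrence-after-offset : ∀ y e t u → 0 < e → word y e ++ u ≡ suffixAt t → offset y ≤ t
  occurrence-after-offset y e t u 0<e occurrence =
    m<1+n⇒m≤n (Tk-[]=-inj₁⁻ (subst (λ n → T [ n ]= inj₁ y) (+-comm t 1) y∈T))
    where
    y∈suffix : suffixAt (offset y) [ 1 ]= inj₁ y
    y∈suffix = prev-[]= (drop (offset y) T)
                 ([]=-drop⁺ (offset y) (subst (λ n → T [ n ]= inj₁ y) (+-comm 1 (offset y)) (Tk-[]=-static y)))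
    1<e+e : 1 < e + e
    1<e+e = +-mono-≤ 0<e 0<e
    y∈T : T [ t + 1 ]= inj₁ y
    y∈T = []=-drop⁻ t (prev-[]=-inj₁⁻ (drop t T)
            (subst (_[ 1 ]= inj₁ y) occurrence ([]=-++ˡ u ([]=-take⁺ (e + e) 1<e+e y∈suffix))))

  quotient-end : ∀ {x d y e} → Valid x d → Valid y e → rest x d ∈ quotient (word y e) (PSuffix T) →
                 end y e ≤ end x d × (end x d ≡ end y e → rest x d ≡ rest y e)
  quotient-end {x} {d} {y} {e} vx vy r∈ with ∈-mapMaybe⁻ (stripPrefix (word y e)) (PSuffix T) r∈
  ... | s , s∈ , strip≡ with ∈-PSuffix⁻ s∈
  ... | t , t≤N , refl = end≤ , same-rest
    where
    occurrence : word y e ++ rest x d ≡ suffixAt t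
    occurrence = sym (stripPrefix-just⁻ (word y e) (suffixAt t) strip≡)

    t+e+e≡end : t + (e + e) ≡ end x d
    t+e+e≡end = +-cancelˡ-≡ (length (rest x d)) (t + (e + e)) (end x d) (begin
      length (rest x d) + (t + (e + e))  ≡⟨ solve 3 (λ r t m → r :+ (t :+ m) := (m :+ r) :+ t) refl
                                              (length (rest x d)) t (e + e) ⟩
      ((e + e) + length (rest x d)) + t  ≡⟨ cong (_+ t) (length-word++ (rest x d) vy) ⟨
      length (word y e ++ rest x d) + t  ≡⟨ cong (λ s → length s + t) occurrence ⟩
      length (suffixAt t) + t            ≡⟨ length-suffixAt t≤N ⟩
      N                                  ≡⟨ length-rest vx ⟨
      length (rest x d) + end x d        ∎)
      where
      open ≡-Reasoning
      open +-*-Solver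

    end≤ : end y e ≤ end x d
    end≤ = subst (end y e ≤_) t+e+e≡end
             (+-monoˡ-≤ (e + e) (occurrence-after-offset y e t (rest x d) (proj₁ vy) occurrence))

    same-rest : end x d ≡ end y e → rest x d ≡ rest y e
    same-rest ends≡ = List.++-cancelˡ (word y e) (rest x d) (rest y e) (begin
      word y e ++ rest x d  ≡⟨ occurrence ⟩
      suffixAt t            ≡⟨ cong suffixAt (+-cancelʳ-≡ (e + e) t (offset y) (trans t+e+e≡end ends≡)) ⟩
      suffixAt (offset y)   ≡⟨ word++rest y e ⟨
      word y e ++ rest y e  ∎)
      where open ≡-Reasoning

  SameLang-end-rest : ∀ {x d y e} → Valid x d → Valid y e →
                      SameLang (quotient (word x d) (PSuffix T)) (quotient (word y e) (PSuffix T)) →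
                      end x d ≡ end y e × rest x d ≡ rest y e
  SameLang-end-rest {x} {d} {y} {e} vx vy (Qx⊆Qy , Qy⊆Qx) = ends≡ , proj₂ y≤x ends≡
    where
    y≤x : end y e ≤ end x d × (end x d ≡ end y e → rest x d ≡ rest y e)
    y≤x = quotient-end vx vy (All.lookup Qx⊆Qy (rest-∈-quotient x d))
    x≤y : end x d ≤ end y e × (end y e ≡ end x d → rest y e ≡ rest x d)
    x≤y = quotient-end vy vx (All.lookup Qy⊆Qx (rest-∈-quotient y e))
    ends≡ : end x d ≡ end y e
    ends≡ = ≤-antisym (proj₁ x≤y) (proj₁ y≤x)

  second-occurrence : ∀ x → ∃ λ c → suffixAt (offset x) [ k + k ]= inj₂ (suc c)
  second-occurrence x = prev-[]=-repeated (drop (offset x) T) x∈ x∈take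
    where
    x∈ : drop (offset x) T [ k + k ]= inj₂ x
    x∈ = []=-drop⁺ (offset x) (subst (λ n → T [ n ]= inj₂ x) (+-comm (k + k) (offset x)) (Tk-[]=-second x))
    0<k+k : 0 < k + k
    0<k+k = <-≤-trans (s≤s z≤n) (≤-trans (Fin.toℕ<n x) (m≤m+n k k))
    x∈take : inj₂ x ∈ take (k + k) (drop (offset x) T)
    x∈take = []=⇒∈ ([]=-take⁺ (k + k) 0<k+k
               ([]=-drop⁺ (offset x)
                 (subst (λ n → T [ n ]= inj₂ x) (sym (+-identityʳ (offset x))) (Tk-[]=-first x))))

  first-occurrence : ∀ (x y : Fin k) q → offset x < offset y → offset y + q ≡ (k + k) + offset x →
                     suffixAt (offset y) [ q ]= inj₂ 0
  first-occurrence x y q x<y position = prev-[]=-fresh (drop (offset y) T) x∈ x∉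
    where
    x∈ : drop (offset y) T [ q ]= inj₂ x
    x∈ = []=-drop⁺ (offset y) (subst (λ n → T [ n ]= inj₂ x) (sym position) (Tk-[]=-second x))
    x∉ : inj₂ x ∉ take q (drop (offset y) T)
    x∉ x∈take with ∈-take⁻ q _ x∈take
    ... | q′ , q′<q , x∈′ with Tk-[]=-inj₂⁻ {k} ([]=-drop⁻ (offset y) x∈′)
    ... | inj₁ eq = <-irrefl (sym eq) (<-≤-trans x<y (m≤m+n (offset y) q′))
    ... | inj₂ eq = <-irrefl (+-cancelˡ-≡ (offset y) q′ q (trans eq (sym position))) q′<q

  rest-separates : ∀ {x d y e} → toℕ x < toℕ y → Valid x d → Valid y e →
                   end x d ≡ end y e → rest x d ≢ rest y e
  rest-separates {x} {d} {y} {e} x<y (_ , x+d≤k) _ ends≡ rests≡ with second-occurrence x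
  ... | c , repeated = 1+n≢0 (Sum.inj₂-injective ([]=-functional repeated′ (subst (_[ r ]= inj₂ 0) (sym rests≡) fresh)))
    where
    r : ℕ
    r = (k + k) ∸ (d + d)
    d+d+r≡k+k : (d + d) + r ≡ k + k
    d+d+r≡k+k = m+[n∸m]≡n (+-mono-≤ (m+n≤o⇒n≤o (toℕ x) x+d≤k) (m+n≤o⇒n≤o (toℕ x) x+d≤k))
    repeated′ : rest x d [ r ]= inj₂ (suc c)
    repeated′ = []=-drop⁺ (d + d) (subst (λ n → suffixAt (offset x) [ n ]= inj₂ (suc c)) (sym d+d+r≡k+k) repeated)
    position : offset y + ((e + e) + r) ≡ (k + k) + offset x
    position = begin
      offset y + ((e + e) + r)  ≡⟨ +-assoc (offset y) (e + e) r ⟨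
      end y e + r               ≡⟨ cong (_+ r) ends≡ ⟨
      end x d + r               ≡⟨ +-assoc (offset x) (d + d) r ⟩
      offset x + ((d + d) + r)  ≡⟨ cong (offset x +_) d+d+r≡k+k ⟩
      offset x + (k + k)        ≡⟨ +-comm (offset x) (k + k) ⟩
      (k + k) + offset x        ∎
      where open ≡-Reasoning
    fresh : rest y e [ r ]= inj₂ 0
    fresh = []=-drop⁺ (e + e) (first-occurrence x y ((e + e) + r) (+-mono-< x<y x<y) position)

  quotient-word-injective : ∀ {x d y e} → Valid x d → Valid y e →
                            SameLang (quotient (word x d) (PSuffix T)) (quotient (word y e) (PSuffix T)) →
                            x ≡ y × d ≡ e
  quotient-word-injective {x} {d} {y} {e} vx vy same with SameLang-end-rest vx vy same | <-cmp (toℕ x) (toℕ y)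
  ... | ends≡ , rests≡ | tri< x<y _ _ = ⊥-elim (rest-separates x<y vx vy ends≡ rests≡)
  ... | ends≡ , rests≡ | tri> _ _ y<x = ⊥-elim (rest-separates y<x vy vx (sym ends≡) (sym rests≡))
  ... | ends≡ , _      | tri≈ _ x≡y _ with Fin.toℕ-injective x≡y
  ... | refl = refl , (begin
    d            ≡⟨ n≡⌊n+n/2⌋ d ⟩
    ⌊ d + d /2⌋  ≡⟨ cong ⌊_/2⌋ (+-cancelˡ-≡ (offset x) (d + d) (e + e) ends≡) ⟩
    ⌊ e + e /2⌋  ≡⟨ n≡⌊n+n/2⌋ e ⟨
    e            ∎)
    where open ≡-Reasoning

  square≤numNodes : ∀ h → h + h ≤ k → h * h ≤ numNodes (PSuffix T)
  square≤numNodes h h+h≤k = numNodes-lowerBound (PSuffix T) (λ i → word (param i) (pairs i))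
    (λ i → word-∈-prefixes (param i) (pairs i)) separated
    where
    a<k : ∀ (a : Fin h) → toℕ a < k
    a<k a = <-≤-trans (Fin.toℕ<n a) (≤-trans (m≤m+n h h) h+h≤k)
    paramOf : Fin h → Fin k
    paramOf a = fromℕ< (a<k a)
    param : Fin (h * h) → Fin k
    param i = paramOf (proj₁ (remQuot {h} h i))
    pairs : Fin (h * h) → ℕ
    pairs i = suc (toℕ (proj₂ (remQuot {h} h i)))
    valid-pair : ∀ a (b : Fin h) → Valid (paramOf a) (suc (toℕ b))
    valid-pair a b = s≤s z≤n , (begin
      toℕ (paramOf a) + suc (toℕ b)  ≡⟨ cong (_+ suc (toℕ b)) (Fin.toℕ-fromℕ< (a<k a)) ⟩
      toℕ a + suc (toℕ b)            ≡⟨ +-suc (toℕ a) (toℕ b) ⟩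
      suc (toℕ a) + toℕ b            ≤⟨ +-mono-≤ (Fin.toℕ<n a) (<⇒≤ (Fin.toℕ<n b)) ⟩
      h + h                          ≤⟨ h+h≤k ⟩
      k                              ∎)
      where open ≤-Reasoning
    valid : ∀ i → Valid (param i) (pairs i)
    valid i = valid-pair (proj₁ (remQuot {h} h i)) (proj₂ (remQuot {h} h i))
    separated : ∀ i j → SameLang (quotient (word (param i) (pairs i)) (PSuffix T))
                                 (quotient (word (param j) (pairs j)) (PSuffix T)) → i ≡ j
    separated i j same with quotient-word-injective (valid i) (valid j) same
    ... | params≡ , pairs≡ = begin
      i                                  ≡⟨ Fin.combine-remQuot {h} h i ⟨
      uncurry combine (remQuot {h} h i)  ≡⟨ cong (uncurry combine) (×-≡,≡→≡ (a≡ , b≡)) ⟩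
      uncurry combine (remQuot {h} h j)  ≡⟨ Fin.combine-remQuot {h} h j ⟩
      j                                  ∎
      where
      open ≡-Reasoning
      a≡ : proj₁ (remQuot {h} h i) ≡ proj₁ (remQuot {h} h j)
      a≡ = Fin.toℕ-injective (trans (sym (Fin.toℕ-fromℕ< (a<k _)))
                                    (trans (cong toℕ params≡) (Fin.toℕ-fromℕ< (a<k _))))
      b≡ : proj₂ (remQuot {h} h i) ≡ proj₂ (remQuot {h} h j)
      b≡ = Fin.toℕ-injective (suc-injective pairs≡)

halves : ∀ k → ∃ λ h → h + h ≤ k × k ≤ suc (h + h)
halves zero          = 0 , z≤n , z≤n
halves (suc zero)    = 0 , z≤n , s≤s z≤n
halves (suc (suc k)) with halves k
... | h , h+h≤k , k≤1+h+h = suc h , subst (_≤ 2 + k) (cong suc (sym (+-suc h h))) (s≤s (s≤s h+h≤k))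
                                  , subst (2 + k ≤_) (cong (2 +_) (sym (+-suc h h))) (s≤s (s≤s k≤1+h+h))

≤3*half : ∀ {k} h → 2 ≤ k → k ≤ suc (h + h) → k ≤ 3 * h
≤3*half zero    (s≤s (s≤s _)) (s≤s ())
≤3*half (suc h) _             k≤1+h′+h′ = ≤-trans k≤1+h′+h′ (begin
  suc (h′ + h′)   ≡⟨ +-comm 1 (h′ + h′) ⟩
  (h′ + h′) + 1   ≤⟨ +-monoʳ-≤ (h′ + h′) (s≤s z≤n) ⟩
  (h′ + h′) + h′  ≡⟨ solve 1 (λ h → (h :+ h) :+ h := con 3 :* h) refl h′ ⟩
  3 * h′          ∎)
  where
  open ≤-Reasoning
  open +-*-Solver
  h′ : ℕ
  h′ = suc h

length-Tk²≤ : ∀ {k h} → 2 ≤ k → k ≤ suc (h + h) → length (Tk k) * length (Tk k) ≤ 144 * (h * h)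
length-Tk²≤ {k} {h} 2≤k k≤1+h+h = begin
  length (Tk k) * length (Tk k)  ≤⟨ *-mono-≤ |Tk|≤12h |Tk|≤12h ⟩
  (12 * h) * (12 * h)            ≡⟨ solve 1 (λ h → (con 12 :* h) :* (con 12 :* h) := con 144 :* (h :* h)) refl h ⟩
  144 * (h * h)                  ∎
  where
  open ≤-Reasoning
  open +-*-Solver
  |Tk|≤12h : length (Tk k) ≤ 12 * h
  |Tk|≤12h = begin
    length (Tk k)      ≡⟨ length-Tk {k} ⟩
    (k + k) + (k + k)  ≡⟨ solve 1 (λ k → (k :+ k) :+ (k :+ k) := con 4 :* k) refl k ⟩
    4 * k              ≤⟨ *-monoʳ-≤ 4 (≤3*half h 2≤k k≤1+h+h) ⟩
    4 * (3 * h)        ≡⟨ *-assoc 4 3 h ⟨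
    12 * h             ∎

length-Tk²≤PSAutoNodes : ∀ k → 2 ≤ k →
                         length (Tk k) * length (Tk k) ≤ 144 * PSAutoNodes (_≟Fin_ {k}) _≟Fin_ (Tk k)
length-Tk²≤PSAutoNodes k 2≤k =
  let h , h+h≤k , k≤1+h+h = halves k
  in ≤-trans (length-Tk²≤ {k} {h} 2≤k k≤1+h+h) (*-monoʳ-≤ 144 (LowerBound.square≤numNodes k h h+h≤k))

proposition1 :
  (Σ[ c ∈ ℕ ] Σ[ n₀ ∈ ℕ ]
     (∀ {Σ Π : Set} (_≟Σ_ : DecidableEquality Σ) (_≟Π_ : DecidableEquality Π)
        (T : PString Σ Π) → n₀ ≤ length T →
        (PSAutoNodes _≟Σ_ _≟Π_ T ≤ c * (length T * length T))
        × (PSAutoEdges _≟Σ_ _≟Π_ T ≤ c * (length T * length T))))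
  × (Σ[ c ∈ ℕ ] Σ[ k₀ ∈ ℕ ]
     (∀ (k : ℕ) → 1 ≤ k → k₀ ≤ k →
        (length (Tk k) * length (Tk k) ≤ c * PSAutoNodes (_≟Fin_ {k}) (_≟Fin_ {k}) (Tk k))
        × (k * k ≤ c * PSAutoNodes (_≟Fin_ {k}) (_≟Fin_ {k}) (Tk k))))
proposition1 = (4 , 1 , upper) , (144 , 2 , lower)
  where
  upper : ∀ {Σ Π : Set} (_≟Σ_ : DecidableEquality Σ) (_≟Π_ : DecidableEquality Π) (T : PString Σ Π) →
          1 ≤ length T → (PSAutoNodes _≟Σ_ _≟Π_ T ≤ 4 * (length T * length T))
                         × (PSAutoEdges _≟Σ_ _≟Π_ T ≤ 4 * (length T * length T))
  upper _≟Σ_ _≟Π_ T 1≤n = ≤-trans (PSAutoNodes≤ _≟Σ_ _≟Π_ T) (suc*suc≤4* (length T) 1≤n)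
                        , ≤-trans (PSAutoEdges≤ _≟Σ_ _≟Π_ T) (suc*suc≤4* (length T) 1≤n)

  lower : ∀ k → 1 ≤ k → 2 ≤ k → (length (Tk k) * length (Tk k) ≤ 144 * PSAutoNodes _≟Fin_ _≟Fin_ (Tk k))
                                × (k * k ≤ 144 * PSAutoNodes _≟Fin_ _≟Fin_ (Tk k))
  lower k _ 2≤k = length-Tk²≤PSAutoNodes k 2≤k
                , ≤-trans (*-mono-≤ k≤|Tk| k≤|Tk|) (length-Tk²≤PSAutoNodes k 2≤k)
    where
    k≤|Tk| : k ≤ length (Tk k)
    k≤|Tk| = subst (k ≤_) (sym (length-Tk {k})) (≤-trans (m≤m+n k k) (m≤m+n (k + k) (k + k)))
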